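{- Let $G$ be a finite simple graph, let $\mathcal{K}_{G^c}=\{K^i\}_{i=1}^d$ be the set of all maximal cliques of its complement $G^c$, and let $\{L,R\}$ be an arbitrary biclique subgraph of $G$. Then there exists a partition $I,J$ of $\llbracket d\rrbracket$ such that, writing $A=\bigcup_{i\in I}K^i$ and $B=\bigcup_{j\in J}K^j$, the pair $\{A\setminus B,\,B\setminus A\}$ is a biclique subgraph of $G$ with $L\subseteq A\setminus B$ and $R\subseteq B\setminus A$ (i.e. $\{L,R\}$ is a subgraph of this biclique).
   Context: $G^c$ is the complement of $G$; $\llbracket d\rrbracket=\{1,\dots,d\}$. For disjoint non-empty vertex sets $L,R$, the biclique $\{L,R\}$ is the complete bipartite graph with parts $L,R$; it is a biclique subgraph of $G$ if every $uv$ with $u\in L$, $v\in R$ is an edge of $G$. -}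

module Defs where

open import Data.Nat using (ℕ)
open import Data.Fin using (Fin)
open import Data.Fin.Subset using (Subset; _∈_; _∉_; _⊆_; Nonempty; ⋃)
open import Data.List using (map; filterᵇ; allFin)
open import Data.Vec using (lookup)
open import Data.Bool using (Bool; true; false)
open import Data.Product using (Σ; ∃; _×_; _,_)
open import Relation.Nullary using (¬_; Dec)
open import Relation.Binary.PropositionalEquality using (_≡_)
open import Function.Definitions using (Injective)

record SimpleGraph (n : ℕ) : Set₁ where
  field
    Adj      : Fin n → Fin n → Set
    adj?     : ∀ u v → Dec (Adj u v)
    sym      : ∀ {u v} → Adj u v → Adj v u
    irrefl   : ∀ {u} → ¬ Adj u u
open SimpleGraph public

ComplAdj : ∀ {n} → SimpleGraph n → Fin n → Fin n → Set
ComplAdj G u v = ¬ (u ≡ v) × ¬ Adj G u v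

IsClique-c : ∀ {n} → SimpleGraph n → Subset n → Set
IsClique-c G K = ∀ u v → u ∈ K → v ∈ K → ¬ (u ≡ v) → ComplAdj G u v

IsMaximalClique-c : ∀ {n} → SimpleGraph n → Subset n → Set
IsMaximalClique-c G K =
  IsClique-c G K × (∀ K′ → IsClique-c G K′ → K ⊆ K′ → K′ ⊆ K)

EnumeratesMaxCliques-c : ∀ {n d} → SimpleGraph n → (Fin d → Subset n) → Set
EnumeratesMaxCliques-c {n} {d} G K =
  Injective _≡_ _≡_ K
  × (∀ i → IsMaximalClique-c G (K i))
  × (∀ C → IsMaximalClique-c G C → ∃ λ i → K i ≡ C)

IsBicliqueSub : ∀ {n} → SimpleGraph n → Subset n → Subset n → Set
IsBicliqueSub G L R =
  Nonempty L × Nonempty R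
  × (∀ v → v ∈ L → v ∉ R)
  × (∀ u v → u ∈ L → v ∈ R → Adj G u v)

BigUnion : ∀ {n d} → (Fin d → Subset n) → Subset d → Subset n
BigUnion {n} {d} K I = ⋃ (map K (filterᵇ (λ i → lookup I i) (allFin d)))

{-# OPTIONS --safe #-}
-- Every clique of Gᶜ, in particular every singleton and every non-edge of G,
-- lies in some maximal clique Kⁱ.  Put i in I when Kⁱ meets L.  A maximal
-- clique meeting L cannot meet R (a vertex of L and one of R are adjacent in
-- G, or equal), so L ⊆ A ∖ B and R ⊆ B ∖ A.  Finally, for any I whatsoever,
-- a non-edge {u , v} lies in a single Kᵏ, which puts u and v both in A or
-- both in B; hence A ∖ B and B ∖ A are completely joined in G.
module Submission where

open import Defs renaming (sym to Adj-sym)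
open import Data.Bool.Properties using (T-≡)
open import Data.Empty using (⊥-elim)
open import Data.Fin using (Fin; zero; _≟_)
open import Data.Nat using (ℕ)
open import Data.Fin.Properties using (any?)
open import Data.Fin.Subset
  using (Subset; inside; outside; _∈_; _∉_; _⊆_; _─_; _∪_; _∩_; ⁅_⁆; ⋃; ∁; Nonempty)
open import Data.Fin.Subset.Properties
  using ( _∈?_; nonempty?; ∉⊥; x∈⁅x⁆; x∈⁅y⁆⇒x≡y; p⊆p∪q; x∈p∪q⁺; x∈p∪q⁻
        ; x∈p∩q⁺; x∈p∩q⁻; x∈∁p⇒x∉p; x∉p⇒x∈∁p; x∈p∧x∉q⇒x∈p─q; p─q⊆p )
open import Data.List using (List; []; _∷_; map; filterᵇ; allFin)
import Data.List.Membership.Propositional as List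
open import Data.List.Membership.Propositional.Properties
  using (∈-allFin; ∈-map⁺; ∈-map⁻; ∈-filter⁺; ∈-filter⁻)
open import Data.List.Relation.Unary.Any using (here; there)
open import Data.Product using (∃; _×_; _,_; proj₁; proj₂)
open import Data.Sum using (_⊎_; inj₁; inj₂)
open import Data.Vec using (_∷_; here; there; lookup; tabulate)
open import Data.Vec.Properties using (lookup∘tabulate; []=⇒lookup; lookup⇒[]=)
open import Function using (_∘_)
open import Function.Bundles using (Equivalence)
open import Level using (Level)
open import Relation.Nullary using (¬_; Dec; yes; no)
open import Relation.Nullary.Decidable using (isYes; toWitness; fromWitness; _×-dec_; ¬?)
open import Relation.Binary.PropositionalEquality using (_≡_; _≢_; refl; sym; trans)
open import Relation.Unary using (Pred; Decidable)

private
  variable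
    ℓ : Level
    n d : ℕ

subsetOf : {P : Pred (Fin n) ℓ} → Decidable P → Subset n
subsetOf P? = tabulate (isYes ∘ P?)

module _ {P : Pred (Fin n) ℓ} (P? : Decidable P) where

  ∈-subsetOf⁺ : ∀ {i} → P i → i ∈ subsetOf P?
  ∈-subsetOf⁺ {i} p =
    lookup⇒[]= i _ (trans (lookup∘tabulate _ i) (Equivalence.to T-≡ (fromWitness p)))

  ∈-subsetOf⁻ : ∀ {i} → i ∈ subsetOf P? → P i
  ∈-subsetOf⁻ {i} i∈ =
    toWitness (Equivalence.from T-≡ (trans (sym (lookup∘tabulate _ i)) ([]=⇒lookup i∈)))

x∈p─q⇒x∉q : ∀ {p q : Subset n} {x} → x ∈ p ─ q → x ∉ q
x∈p─q⇒x∉q {p = inside ∷ _} {q = outside ∷ _} here ()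
x∈p─q⇒x∉q {p = _ ∷ _} {q = inside ∷ _} {x = zero} ()
x∈p─q⇒x∉q {p = _ ∷ _} {q = _ ∷ _} (there m) (there m′) = x∈p─q⇒x∉q m m′

x∈⋃⁺ : ∀ {ps : List (Subset n)} {p x} → p List.∈ ps → x ∈ p → x ∈ ⋃ ps
x∈⋃⁺ (here refl) x∈p = x∈p∪q⁺ (inj₁ x∈p)
x∈⋃⁺ (there p∈)  x∈p = x∈p∪q⁺ (inj₂ (x∈⋃⁺ p∈ x∈p))

x∈⋃⁻ : ∀ (ps : List (Subset n)) {x} → x ∈ ⋃ ps → ∃ λ p → p List.∈ ps × x ∈ p
x∈⋃⁻ []       x∈ = ⊥-elim (∉⊥ x∈)
x∈⋃⁻ (p ∷ ps) x∈ with x∈p∪q⁻ p (⋃ ps) x∈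
... | inj₁ x∈p = p , here refl , x∈p
... | inj₂ x∈⋃ with q , q∈ , x∈q ← x∈⋃⁻ ps x∈⋃ = q , there q∈ , x∈q

⁅⁆-unique : ∀ {x y} (z : Fin n) → x ∈ ⁅ z ⁆ → y ∈ ⁅ z ⁆ → x ≡ y
⁅⁆-unique z x∈ y∈ = trans (x∈⁅y⁆⇒x≡y z x∈) (sym (x∈⁅y⁆⇒x≡y z y∈))

x∈⁅x⁆∪⁅y⁆ : ∀ (x y : Fin n) → x ∈ ⁅ x ⁆ ∪ ⁅ y ⁆
x∈⁅x⁆∪⁅y⁆ x y = x∈p∪q⁺ (inj₁ (x∈⁅x⁆ x))

y∈⁅x⁆∪⁅y⁆ : ∀ (x y : Fin n) → y ∈ ⁅ x ⁆ ∪ ⁅ y ⁆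
y∈⁅x⁆∪⁅y⁆ x y = x∈p∪q⁺ (inj₂ (x∈⁅x⁆ y))

module _ (K : Fin d → Subset n) (I : Subset d) where

  private
    indices : List (Fin d)
    indices = filterᵇ (lookup I) (allFin d)

  x∈BigUnion⁺ : ∀ {i x} → i ∈ I → x ∈ K i → x ∈ BigUnion K I
  x∈BigUnion⁺ {i} i∈I =
    x∈⋃⁺ (∈-map⁺ K (∈-filter⁺ _ (∈-allFin i) (Equivalence.from T-≡ ([]=⇒lookup i∈I))))

  x∈BigUnion⁻ : ∀ {x} → x ∈ BigUnion K I → ∃ λ i → i ∈ I × x ∈ K i
  x∈BigUnion⁻ x∈ with p , p∈ , x∈p ← x∈⋃⁻ (map K indices) x∈
                  with i , i∈ , refl ← ∈-map⁻ K p∈ =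
    i , lookup⇒[]= i I (Equivalence.to T-≡ (proj₂ (∈-filter⁻ _ {xs = allFin d} i∈))) , x∈p

module _ (G : SimpleGraph n) where

  nonEdge-isClique-c : ∀ {u v} → ¬ Adj G u v → IsClique-c G (⁅ u ⁆ ∪ ⁅ v ⁆)
  nonEdge-isClique-c {u} {v} ¬uv a b a∈ b∈ a≢b
    with x∈p∪q⁻ ⁅ u ⁆ ⁅ v ⁆ a∈ | x∈p∪q⁻ ⁅ u ⁆ ⁅ v ⁆ b∈
  ... | inj₁ a∈u | inj₁ b∈u = ⊥-elim (a≢b (⁅⁆-unique u a∈u b∈u))
  ... | inj₂ a∈v | inj₂ b∈v = ⊥-elim (a≢b (⁅⁆-unique v a∈v b∈v))
  ... | inj₁ a∈u | inj₂ b∈v rewrite x∈⁅y⁆⇒x≡y u a∈u | x∈⁅y⁆⇒x≡y v b∈v = a≢b , ¬uv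
  ... | inj₂ a∈v | inj₁ b∈u rewrite x∈⁅y⁆⇒x≡y v a∈v | x∈⁅y⁆⇒x≡y u b∈u = a≢b , ¬uv ∘ Adj-sym G

  Conflict : Subset n → Fin n → Set
  Conflict C v = ∃ λ u → u ∈ C × u ≢ v × Adj G u v

  conflict? : ∀ C v → Dec (Conflict C v)
  conflict? C v = any? λ u → (u ∈? C) ×-dec (¬? (u ≟ v) ×-dec adj? G u v)

  Conflict-mono : ∀ {C C′ v} → C ⊆ C′ → Conflict C v → Conflict C′ v
  Conflict-mono C⊆C′ (u , u∈C , rest) = u , C⊆C′ u∈C , rest

  ∪⁅⁆-isClique-c : ∀ {C v} → IsClique-c G C → ¬ Conflict C v → IsClique-c G (C ∪ ⁅ v ⁆)
  ∪⁅⁆-isClique-c {C} {v} clique ¬conflict a b a∈ b∈ a≢b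
    with x∈p∪q⁻ C ⁅ v ⁆ a∈ | x∈p∪q⁻ C ⁅ v ⁆ b∈
  ... | inj₁ a∈C | inj₁ b∈C = clique a b a∈C b∈C a≢b
  ... | inj₁ a∈C | inj₂ b∈v rewrite x∈⁅y⁆⇒x≡y v b∈v =
    a≢b , λ ab → ¬conflict (a , a∈C , a≢b , ab)
  ... | inj₂ a∈v | inj₁ b∈C rewrite x∈⁅y⁆⇒x≡y v a∈v =
    a≢b , λ ab → ¬conflict (b , b∈C , a≢b ∘ sym , Adj-sym G ab)
  ... | inj₂ a∈v | inj₂ b∈v = ⊥-elim (a≢b (⁅⁆-unique v a∈v b∈v))

  -- Greedy extension: scan the vertices, adding each one that conflicts with
  -- nothing added so far; a vertex left out conflicts with the final clique.

  grow : Subset n → Fin n → Subset n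
  grow C v with conflict? C v
  ... | yes _ = C
  ... | no _  = C ∪ ⁅ v ⁆

  ⊆-grow : ∀ C v → C ⊆ grow C v
  ⊆-grow C v with conflict? C v
  ... | yes _ = λ x∈ → x∈
  ... | no _  = p⊆p∪q _

  grow-isClique-c : ∀ C v → IsClique-c G C → IsClique-c G (grow C v)
  grow-isClique-c C v clique with conflict? C v
  ... | yes _        = clique
  ... | no ¬conflict = ∪⁅⁆-isClique-c clique ¬conflict

  grow-absorbs : ∀ C v → v ∈ grow C v ⊎ Conflict C v
  grow-absorbs C v with conflict? C v
  ... | yes conflict = inj₂ conflict
  ... | no _         = inj₁ (x∈p∪q⁺ (inj₂ (x∈⁅x⁆ v)))

  growAll : List (Fin n) → Subset n → Subset n
  growAll []       C = C
  growAll (v ∷ vs) C = growAll vs (grow C v)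

  ⊆-growAll : ∀ vs C → C ⊆ growAll vs C
  ⊆-growAll []       C = λ x∈ → x∈
  ⊆-growAll (v ∷ vs) C = ⊆-growAll vs (grow C v) ∘ ⊆-grow C v

  growAll-isClique-c : ∀ vs C → IsClique-c G C → IsClique-c G (growAll vs C)
  growAll-isClique-c []       C = λ clique → clique
  growAll-isClique-c (v ∷ vs) C = growAll-isClique-c vs (grow C v) ∘ grow-isClique-c C v

  growAll-absorbs : ∀ vs C {v} → v List.∈ vs → v ∈ growAll vs C ⊎ Conflict (growAll vs C) v
  growAll-absorbs (v ∷ vs) C (here refl) with grow-absorbs C v
  ... | inj₁ v∈    = inj₁ (⊆-growAll vs (grow C v) v∈)
  ... | inj₂ clash = inj₂ (Conflict-mono (⊆-growAll vs (grow C v) ∘ ⊆-grow C v) clash)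
  growAll-absorbs (_ ∷ vs) C (there v∈vs) = growAll-absorbs vs _ v∈vs

  maximalClique-c-extension : ∀ {C} → IsClique-c G C →
    ∃ λ M → IsMaximalClique-c G M × C ⊆ M
  maximalClique-c-extension {C} clique =
    M , (growAll-isClique-c vs C clique , maximal) , ⊆-growAll vs C
    where
    vs = allFin n
    M  = growAll vs C

    maximal : ∀ K′ → IsClique-c G K′ → M ⊆ K′ → K′ ⊆ M
    maximal K′ clique′ M⊆K′ {v} v∈K′ with growAll-absorbs vs C (∈-allFin v)
    ... | inj₁ v∈M                  = v∈M
    ... | inj₂ (u , u∈M , u≢v , uv) = ⊥-elim (proj₂ (clique′ u v (M⊆K′ u∈M) v∈K′ u≢v) uv)

CoversCliques-c : SimpleGraph n → (Fin d → Subset n) → Set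
CoversCliques-c G K = ∀ C → IsClique-c G C → ∃ λ i → C ⊆ K i

maxCliques-c-cover : ∀ (G : SimpleGraph n) (K : Fin d → Subset n) →
  EnumeratesMaxCliques-c G K → CoversCliques-c G K
maxCliques-c-cover G K (_ , _ , complete) C clique
  with M , isMax , C⊆M ← maximalClique-c-extension G clique
  with i , refl ← complete M isMax = i , C⊆M

clique-c-meets-one-side : ∀ (G : SimpleGraph n) {L R C u v} →
  IsBicliqueSub G L R → IsClique-c G C → u ∈ L → v ∈ R → u ∈ C → v ∉ C
clique-c-meets-one-side G {u = u} {v} (_ , _ , disjoint , complete) clique u∈L v∈R u∈C v∈C
  with u ≟ v
... | yes refl = disjoint u u∈L v∈R
... | no u≢v   = proj₂ (clique u v u∈C v∈C u≢v) (complete u v u∈L v∈R)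

module _ (G : SimpleGraph n) (K : Fin d → Subset n) (covers : CoversCliques-c G K) where

  inSomeClique : ∀ u → ∃ λ i → u ∈ K i
  inSomeClique u with i , ⊆K ← covers _ (nonEdge-isClique-c G (irrefl G)) =
    i , ⊆K (x∈⁅x⁆∪⁅y⁆ u u)

  module _ (I : Subset d) where

    private
      A = BigUnion K I
      B = BigUnion K (∁ I)

    separated-adjacent : ∀ {u v} → u ∈ A ─ B → v ∈ B ─ A → Adj G u v
    separated-adjacent {u} {v} u∈A─B v∈B─A with adj? G u v
    ... | yes uv = uv
    ... | no ¬uv with k , ⊆K ← covers _ (nonEdge-isClique-c G ¬uv) with k ∈? I
    ...   | yes k∈I = ⊥-elim (x∈p─q⇒x∉q v∈B─A v∈A)
      where v∈A = x∈BigUnion⁺ K I k∈I (⊆K (y∈⁅x⁆∪⁅y⁆ u v))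
    ...   | no k∉I  = ⊥-elim (x∈p─q⇒x∉q u∈A─B u∈B)
      where u∈B = x∈BigUnion⁺ K (∁ I) (x∉p⇒x∈∁p k∉I) (⊆K (x∈⁅x⁆∪⁅y⁆ u v))

meets? : (K : Fin d → Subset n) (S : Subset n) → Decidable (λ i → Nonempty (S ∩ K i))
meets? K S i = nonempty? (S ∩ K i)

meeting : (Fin d → Subset n) → Subset n → Subset d
meeting K S = subsetOf (meets? K S)

module _ (G : SimpleGraph n) (K : Fin d → Subset n)
         (covers : CoversCliques-c G K) (cliques : ∀ i → IsClique-c G (K i))
         {L R : Subset n} (biclique : IsBicliqueSub G L R) where

  private
    I = meeting K L
    A = BigUnion K I
    B = BigUnion K (∁ I)

    ∈meeting : ∀ {i u} → u ∈ L → u ∈ K i → i ∈ I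
    ∈meeting u∈L u∈K = ∈-subsetOf⁺ (meets? K L) (_ , x∈p∩q⁺ (u∈L , u∈K))

    ∉meeting : ∀ {i v} → v ∈ R → v ∈ K i → i ∉ I
    ∉meeting {i} v∈R v∈K i∈I with u , u∈L∩K ← ∈-subsetOf⁻ (meets? K L) i∈I
                             with u∈L , u∈K ← x∈p∩q⁻ L (K i) u∈L∩K =
      clique-c-meets-one-side G biclique (cliques i) u∈L v∈R u∈K v∈K

  L⊆A─B : L ⊆ A ─ B
  L⊆A─B {u} u∈L with i , u∈K ← inSomeClique G K covers u =
    x∈p∧x∉q⇒x∈p─q (x∈BigUnion⁺ K I (∈meeting u∈L u∈K) u∈K) u∉B
    where
    u∉B : u ∉ B
    u∉B u∈B with j , j∈∁I , u∈Kⱼ ← x∈BigUnion⁻ K (∁ I) u∈B =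
      x∈∁p⇒x∉p {p = I} j∈∁I (∈meeting u∈L u∈Kⱼ)

  R⊆B─A : R ⊆ B ─ A
  R⊆B─A {v} v∈R with i , v∈K ← inSomeClique G K covers v =
    x∈p∧x∉q⇒x∈p─q (x∈BigUnion⁺ K (∁ I) (x∉p⇒x∈∁p {p = I} (∉meeting v∈R v∈K)) v∈K) v∉A
    where
    v∉A : v ∉ A
    v∉A v∈A with j , j∈I , v∈Kⱼ ← x∈BigUnion⁻ K I v∈A = ∉meeting v∈R v∈Kⱼ j∈I

mainTheorem2 : ∀ {n d} (G : SimpleGraph n) (K : Fin d → Subset n) →
    EnumeratesMaxCliques-c G K →
    (L R : Subset n) → IsBicliqueSub G L R →
    ∃ λ (I : Subset d) →
    let A = BigUnion K I
        B = BigUnion K (∁ I)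
    in IsBicliqueSub G (A ─ B) (B ─ A) × L ⊆ A ─ B × R ⊆ B ─ A
mainTheorem2 G K enum@(_ , maximal , _) L R biclique@((u , u∈L) , (v , v∈R) , _) =
  meeting K L
  , ( (u , L⊆ u∈L) , (v , R⊆ v∈R)
    , (λ w w∈A─B w∈B─A → x∈p─q⇒x∉q w∈B─A (p─q⊆p _ _ w∈A─B))
    , (λ _ _ → separated-adjacent G K covers (meeting K L)) )
  , L⊆ , R⊆
  where
  covers  = maxCliques-c-cover G K enum
  cliques = proj₁ ∘ maximal
  L⊆ = L⊆A─B G K covers cliques biclique
  R⊆ = R⊆B─A G K covers cliques biclique
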